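{- Let $n\ge1$. If $(b,a)$ is $n$-good and $s(n)=s>2$, then $a\le f_{s-1}$ and $b\le 2f_{s-1}$.
   Context: $f_k$ are the Fibonacci numbers, $f_1=f_2=1$, $f_{k+2}=f_{k+1}+f_k$. For positive integers $a_1,a_2$, $w_k=w_k(a_1,a_2)$ is the sequence with $w_1=a_1$, $w_2=a_2$, $w_{k+2}=w_{k+1}+w_k$. Let $s(n;a_1,a_2)$ be the integer $s$ with $w_s(a_1,a_2)=n$ ($-\infty$ if none), and $s(n)=\max_{a_1,a_2\ge1}s(n;a_1,a_2)$. A pair $(a_1,a_2)$ is $n$-good if $a_1,a_2\ge1$ and $s(n;a_1,a_2)=s(n)$. -}

module Defs where

open import Data.Nat using (ℕ; zero; suc; _+_; _≤_)
open import Data.Product using (Σ; ∃; _×_)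
open import Relation.Binary.PropositionalEquality using (_≡_)

fib : ℕ → ℕ
fib zero = zero
fib (suc zero) = 1
fib (suc (suc k)) = fib (suc k) + fib k

-- w k a₁ a₂ : w₁ = a₁, w₂ = a₂, w_{k+2} = w_{k+1} + w_k  (index 0 is junk, never used).
w : ℕ → ℕ → ℕ → ℕ
w zero a₁ a₂ = 0
w (suc zero) a₁ a₂ = a₁
w (suc (suc zero)) a₁ a₂ = a₂
w (suc (suc (suc k))) a₁ a₂ = w (suc (suc k)) a₁ a₂ + w (suc k) a₁ a₂

sPairIs : ℕ → ℕ → ℕ → ℕ → Set
sPairIs n a₁ a₂ s =
  (1 ≤ s) × (w s a₁ a₂ ≡ n) × (∀ k → 1 ≤ k → w k a₁ a₂ ≡ n → k ≤ s)

sIs : ℕ → ℕ → Set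
sIs n s =
  (Σ ℕ λ a₁ → Σ ℕ λ a₂ → (1 ≤ a₁) × (1 ≤ a₂) × sPairIs n a₁ a₂ s) ×
  (∀ a₁ a₂ t → 1 ≤ a₁ → 1 ≤ a₂ → sPairIs n a₁ a₂ t → t ≤ s)

nGood : ℕ → ℕ → ℕ → Set
nGood n a₁ a₂ = (1 ≤ a₁) × (1 ≤ a₂) × (∃ λ s → sIs n s × sPairIs n a₁ a₂ s)

{-# OPTIONS --safe #-}
module Submission where

open import Defs
open import Data.Nat using (ℕ; _≤_; _<_; _∸_; _*_)
open import Data.Product using (_×_)
open import Data.Nat using (zero; suc; _+_; z≤n; s≤s; >-nonZero)
open import Data.Nat.Properties
open import Data.Nat.Tactic.RingSolver using (solve-∀)
open import Data.Product using (_,_; proj₁; proj₂)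
open import Data.Sum using (inj₁; inj₂)
open import Relation.Binary.PropositionalEquality

-- With p = f_{s-2} and q = f_{s-1} we have n = w_s(b,a) = p b + q a, while
-- w_{s+1}(x,y) = q x + (q + p) y; since s(n) = s, the latter value is never n
-- for positive x, y. If k q < b, then x = a + k (q + p) - b, y = b - k q would
-- be such a pair as soon as x > 0, so a + k (q + p) ≤ b. For k ≥ 2 this pushes
-- b above (k + 1) q, which cannot go on forever, so b ≤ 2 q; and k = 1 with
-- a > q would force b > 2 q.

fib-positive : ∀ m → 1 ≤ fib (suc m)
fib-positive zero = s≤s z≤n
fib-positive (suc m) = ≤-trans (fib-positive m) (m≤m+n _ _)

fib[2+m]≤2*fib[1+m] : ∀ m → fib (2 + m) ≤ 2 * fib (1 + m)
fib[2+m]≤2*fib[1+m] zero = s≤s z≤n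
fib[2+m]≤2*fib[1+m] (suc m) =
  +-monoʳ-≤ (fib (2 + m)) (≤-trans (m≤m+n (fib (1 + m)) (fib m)) (m≤m+n _ 0))

w≡fib-combination : ∀ m x y → w (2 + m) x y ≡ fib m * x + fib (1 + m) * y
w≡fib-combination zero x y = sym (+-identityʳ y)
w≡fib-combination (suc zero) x y = w₃ x y
  where
  w₃ : ∀ x y → y + x ≡ (x + 0) + (y + 0)
  w₃ = solve-∀
w≡fib-combination (suc (suc m)) x y = begin
  w (3 + m) x y + w (2 + m) x y
    ≡⟨ cong₂ _+_ (w≡fib-combination (suc m) x y) (w≡fib-combination m x y) ⟩
  (B * x + (B + A) * y) + (A * x + B * y)
    ≡⟨ fibonacci-step A B x y ⟩
  (B + A) * x + ((B + A) + B) * y ∎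
  where
  open ≡-Reasoning
  A = fib m
  B = fib (1 + m)
  fibonacci-step : ∀ A B x y →
    (B * x + (B + A) * y) + (A * x + B * y) ≡ (B + A) * x + ((B + A) + B) * y
  fibonacci-step = solve-∀

module _ {x y : ℕ} (1≤x : 1 ≤ x) (1≤y : 1 ≤ y) where

  w-positive : ∀ k → 1 ≤ w (suc k) x y
  w-positive zero = 1≤x
  w-positive (suc zero) = 1≤y
  w-positive (suc (suc k)) = ≤-trans (w-positive (suc k)) (m≤m+n _ _)

  w-<-step : ∀ k → w (2 + k) x y < w (3 + k) x y
  w-<-step k = m<m+n _ (w-positive k)

  w-<-mono : ∀ {i j} → i < j → w (2 + i) x y < w (2 + j) x y
  w-<-mono {i} {suc j} (s≤s i≤j) with m≤n⇒m<n∨m≡n i≤j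
  ... | inj₁ i<j = <-trans (w-<-mono i<j) (w-<-step j)
  ... | inj₂ refl = w-<-step i

  -- The first term may exceed the second, but from index 2 on the sequence
  -- is strictly increasing, so a hit at an index ≥ 2 is the last one.
  sPairIs-from-index-2 : ∀ {n} i → w (2 + i) x y ≡ n → sPairIs n x y (2 + i)
  sPairIs-from-index-2 i hit = s≤s z≤n , hit , last
    where
    last : ∀ k → 1 ≤ k → w k x y ≡ _ → k ≤ 2 + i
    last (suc zero) _ _ = s≤s z≤n
    last (suc (suc j)) _ hit′ =
      ≮⇒≥ λ 2+i<2+j → <⇒≢ (w-<-mono (≤-pred (≤-pred 2+i<2+j))) (trans hit (sym hit′))

sIs-unique : ∀ {n s t} → sIs n s → sIs n t → s ≡ t
sIs-unique ((x , y , 1≤x , 1≤y , pair) , s-max) ((x′ , y′ , 1≤x′ , 1≤y′ , pair′) , t-max) =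
  ≤-antisym (t-max x y _ 1≤x 1≤y pair) (s-max x′ y′ _ 1≤x′ 1≤y′ pair′)

no-pair-beyond-s : ∀ {n r x y} → sIs n (suc r) → 1 ≤ x → 1 ≤ y → w (2 + r) x y ≢ n
no-pair-beyond-s {r = r} (_ , s-max) 1≤x 1≤y hit =
  <-irrefl refl (s-max _ _ _ 1≤x 1≤y (sPairIs-from-index-2 1≤x 1≤y r hit))

shifted-pair-value : ∀ p q a b k x y → b ≡ k * q + y → a + k * (q + p) ≡ b + x →
  q * x + (q + p) * y ≡ p * b + q * a
shifted-pair-value p q a b k x y refl shift = +-cancelʳ-≡ (q * b) _ _ (begin
  q * x + (q + p) * y + q * b   ≡⟨ regroup₁ p q b x y ⟩
  q * (b + x) + (q + p) * y     ≡⟨ cong (λ z → q * z + (q + p) * y) (sym shift) ⟩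
  q * (a + k * (q + p)) + (q + p) * y ≡⟨ regroup₂ p q a k y ⟩
  p * b + q * a + q * b         ∎)
  where
  open ≡-Reasoning
  regroup₁ : ∀ p q b x y → q * x + (q + p) * y + q * b ≡ q * (b + x) + (q + p) * y
  regroup₁ = solve-∀
  regroup₂ : ∀ p q a k y →
    q * (a + k * (q + p)) + (q + p) * y ≡ p * (k * q + y) + q * a + q * (k * q + y)
  regroup₂ = solve-∀

module _ {p q a b : ℕ} (1≤a : 1 ≤ a) (1≤b : 1 ≤ b) (1≤q : 1 ≤ q) (q≤2p : q ≤ 2 * p)
         (unrepresentable : ∀ x y → 1 ≤ x → 1 ≤ y → q * x + (q + p) * y ≢ p * b + q * a)
         where

  a+k[q+p]≤b : ∀ k → k * q < b → a + k * (q + p) ≤ b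
  a+k[q+p]≤b k kq<b = ≮⇒≥ λ b<shift →
    unrepresentable _ _ (m<n⇒0<n∸m b<shift) (m<n⇒0<n∸m kq<b)
      (shifted-pair-value p q a b k _ _
        (sym (m+[n∸m]≡n (<⇒≤ kq<b))) (sym (m+[n∸m]≡n (<⇒≤ b<shift))))

  [3+j]q<b : ∀ j → (2 + j) * q < b → (3 + j) * q < b
  [3+j]q<b j lt = begin-strict
    q + (2 + j) * q       ≤⟨ +-monoˡ-≤ _ (≤-trans q≤2p (*-monoˡ-≤ p (m≤m+n 2 j))) ⟩
    (2 + j) * p + (2 + j) * q ≡⟨ +-comm ((2 + j) * p) _ ⟩
    (2 + j) * q + (2 + j) * p ≡⟨ sym (*-distribˡ-+ (2 + j) q p) ⟩
    (2 + j) * (q + p)     <⟨ m<n+m _ 1≤a ⟩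
    a + (2 + j) * (q + p) ≤⟨ a+k[q+p]≤b (2 + j) lt ⟩
    b                     ∎
    where open ≤-Reasoning

  b≤2q : b ≤ 2 * q
  b≤2q = ≮⇒≥ λ 2q<b → <-irrefl refl (begin-strict
    b           <⟨ m<n+m b {2} (s≤s z≤n) ⟩
    2 + b       ≤⟨ m≤m*n (2 + b) q {{>-nonZero 1≤q}} ⟩
    (2 + b) * q <⟨ all-multiples-below 2q<b b ⟩
    b           ∎)
    where
    open ≤-Reasoning
    all-multiples-below : 2 * q < b → ∀ j → (2 + j) * q < b
    all-multiples-below 2q<b zero = 2q<b
    all-multiples-below 2q<b (suc j) = [3+j]q<b j (all-multiples-below 2q<b j)

  a≤q : a ≤ q
  a≤q = ≮⇒≥ λ q<a → <-irrefl refl (begin-strict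
    q + 1 * q         <⟨ +-mono-<-≤ q<a (*-monoʳ-≤ 1 (m≤m+n q p)) ⟩
    a + 1 * (q + p)   ≤⟨ a+k[q+p]≤b 1 (subst (_< b) (sym (*-identityˡ q)) (<-≤-trans q<a a≤b)) ⟩
    b                 ≤⟨ b≤2q ⟩
    2 * q             ∎)
    where
    open ≤-Reasoning
    a≤b : a ≤ b
    a≤b = ≤-trans (m≤m+n a 0) (a+k[q+p]≤b 0 1≤b)

lemma11 : (n b a s : ℕ) → 1 ≤ n → nGood n b a → sIs n s → 2 < s →
    (a ≤ fib (s ∸ 1)) × (b ≤ 2 * fib (s ∸ 1))
lemma11 n b a (suc (suc (suc m))) _ (1≤b , 1≤a , s′ , s′-max , s′-pair) s-max _ =
  a≤q 1≤a 1≤b 1≤q q≤2p unrepresentable , b≤2q 1≤a 1≤b 1≤q q≤2p unrepresentable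
  where
  p = fib (1 + m)
  q = fib (2 + m)
  1≤q = fib-positive (1 + m)
  q≤2p = fib[2+m]≤2*fib[1+m] m
  value : p * b + q * a ≡ n
  value = trans (sym (w≡fib-combination (1 + m) b a))
                (subst (λ t → w t b a ≡ n) (sIs-unique s′-max s-max) (proj₁ (proj₂ s′-pair)))
  unrepresentable : ∀ x y → 1 ≤ x → 1 ≤ y → q * x + (q + p) * y ≢ p * b + q * a
  unrepresentable x y 1≤x 1≤y hit =
    no-pair-beyond-s s-max 1≤x 1≤y (trans (w≡fib-combination (2 + m) x y) (trans hit value))
lemma11 n b a (suc (suc zero)) _ _ _ (s≤s (s≤s ()))
lemma11 n b a (suc zero) _ _ _ (s≤s ())
lemma11 n b a zero _ _ _ ()
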